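{- Let $n\ge 1$ and let $G$ be a graph on $n$ vertices that contains none of $K_{1,3}$, $K_3$, $P_3$ as an induced subgraph. Then every connected component of $G$ is isomorphic to one of $C_4$, $K_1$, $K_2$, $P_2$. Moreover, $e(G)\le h(n)-1$, where $h(n)=n+1$ if $n\equiv 0\pmod 4$ and $h(n)=n$ otherwise; and equality $e(G)=h(n)-1$ holds if and only if $G$ is isomorphic to the disjoint union $J\cup\bigcup_{i=1}^{q}C_4$ of $J$ and $q$ copies of $C_4$, where $J\in\{\emptyset,K_1,K_2,P_2\}$ and $q=\lfloor n/4\rfloor$.
   Context: $K_{1,3}$ is the star with three leaves, $K_3$ the triangle, $P_k$ the path with $k$ edges, $C_k$ the cycle with $k$ edges, $K_1$ a single vertex, $K_2$ a single edge, and $\emptyset$ the empty graph (no vertices). $e(G)$ is the number of edges of $G$. -}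

module Defs where

open import Data.Bool using (Bool; true; false; not; _∧_; _∨_; if_then_else_)
open import Data.Nat using (ℕ; zero; suc; _+_; _*_; _∸_; _≡ᵇ_; ∣_-_∣; _%_; _<ᵇ_)
open import Data.Nat.Properties using ()
open import Data.Fin using (Fin; toℕ; splitAt)
open import Data.Sum using (inj₁; inj₂)
open import Data.Product using (Σ; ∃; _×_)
open import Relation.Binary.PropositionalEquality using (_≡_)
open import Function.Definitions using (Injective)

Graph : ℕ → Set
Graph n = Fin n → Fin n → Bool

IsSimple : ∀ {n} → Graph n → Set
IsSimple G = (∀ i j → G i j ≡ G j i) × (∀ i → G i i ≡ false)

sumFin : ∀ {n} → (Fin n → ℕ) → ℕ
sumFin {zero} f = 0
sumFin {suc n} f = f Fin.zero + sumFin (λ i → f (Fin.suc i))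

edges : ∀ {n} → Graph n → ℕ
edges G = sumFin (λ i → sumFin (λ j →
  if (toℕ i <ᵇ toℕ j) ∧ G i j then 1 else 0))

Induced : ∀ {k n} → Graph k → Graph n → Set
Induced {k} {n} H G =
  Σ (Fin k → Fin n) λ f → Injective _≡_ _≡_ f × (∀ a b → G (f a) (f b) ≡ H a b)

data Reach {n} (G : Graph n) : Fin n → Fin n → Set where
  here : ∀ {u} → Reach G u u
  step : ∀ {u w v} → G u w ≡ true → Reach G w v → Reach G u v

record Iso {n m} (G : Graph n) (H : Graph m) : Set where
  field
    to       : Fin n → Fin m
    from     : Fin m → Fin n
    from-to  : ∀ i → from (to i) ≡ i
    to-from  : ∀ j → to (from j) ≡ j
    preserve : ∀ i j → H (to i) (to j) ≡ G i j

emptyG : Graph 0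
emptyG () _

K1 : Graph 1
K1 _ _ = false

Kc : (k : ℕ) → Graph k
Kc k i j = not (toℕ i ≡ᵇ toℕ j)

K2 : Graph 2
K2 = Kc 2

K3 : Graph 3
K3 = Kc 3

-- path with k edges: vertices 0..k, i ~ j iff |i-j| = 1
Pk : (k : ℕ) → Graph (suc k)
Pk k i j = ∣ toℕ i - toℕ j ∣ ≡ᵇ 1

P2 : Graph 3
P2 = Pk 2

P3 : Graph 4
P3 = Pk 3

-- cycle 0-1-2-3-0 : i ~ j iff i, j have different parity
C4 : Graph 4
C4 i j = not ((toℕ i % 2) ≡ᵇ (toℕ j % 2))

-- star K_{1,3}: center 0, leaves 1,2,3
K13 : Graph 4
K13 i j = not ((toℕ i ≡ᵇ 0) ≡ᵇ' (toℕ j ≡ᵇ 0))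
  where
  _≡ᵇ'_ : Bool → Bool → Bool
  true ≡ᵇ' b = b
  false ≡ᵇ' b = not b

_⊕_ : ∀ {a b} → Graph a → Graph b → Graph (a + b)
_⊕_ {a} G H i j with splitAt a i | splitAt a j
... | inj₁ x | inj₁ y = G x y
... | inj₂ x | inj₂ y = H x y
... | inj₁ _ | inj₂ _ = false
... | inj₂ _ | inj₁ _ = false

copies : ∀ {m} (q : ℕ) → Graph m → Graph (q * m)
copies zero H = emptyG
copies (suc q) H = H ⊕ copies q H

data CompType : Set where
  cC4 cK1 cK2 cP2 : CompType

csize : CompType → ℕ
csize cC4 = 4
csize cK1 = 1
csize cK2 = 2
csize cP2 = 3

cgraph : (c : CompType) → Graph (csize c)
cgraph cC4 = C4
cgraph cK1 = K1
cgraph cK2 = K2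
cgraph cP2 = P2

data JType : Set where
  jE jK1 jK2 jP2 : JType

jsize : JType → ℕ
jsize jE = 0
jsize jK1 = 1
jsize jK2 = 2
jsize jP2 = 3

jgraph : (J : JType) → Graph (jsize J)
jgraph jE = emptyG
jgraph jK1 = K1
jgraph jK2 = K2
jgraph jP2 = P2

h : ℕ → ℕ
h n with n % 4
... | zero = suc n
... | suc _ = n

-- In a simple graph without induced K13, K3, P3 a vertex has at most two neighbours (three would
-- span a triangle or a claw).  A short case analysis on the neighbourhood of a vertex v
-- (LocalStructure.classify) then finds an induced K1, K2, P2 or C4 through v whose vertex set is
-- closed under adjacency; closed sets are unions of reachability classes, so this is the
-- component of v (component-reach).  Splitting such a closed induced subgraph off (split) and
-- recursing on the number of vertices writes G, up to isomorphism, as a disjoint union of these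
-- components (decompose).  Edge counts are invariant under isomorphism (by the handshake lemma)
-- and additive over ⊕, so e(G) = n - d where d is the number of components other than C4.
-- As a union of 4-cycles has order divisible by 4, d ≥ 1 unless 4 ∣ n: this is e(G) ≤ h(n) - 1.
-- In the extremal case every component is a C4 if 4 ∣ n; otherwise some vertex has degree < 2
-- (else the handshake lemma gives n edges), and splitting off its component first leaves only
-- 4-cycles.  Conversely the edges of J ⊕ q C4 are counted directly.

module Submission where

open import Defs
open import Data.Nat using (ℕ; _≤_; _∸_; _/_)
open import Data.Fin using (Fin)
open import Data.Product using (Σ; ∃; ∃-syntax; _×_)
open import Relation.Nullary using (¬_)
open import Relation.Binary.PropositionalEquality using (_≡_)
open import Function.Definitions using (Injective)
open import Function.Bundles using (_⇔_)

open import Data.Nat using (zero; suc; _+_; _*_; _<_; _<ᵇ_; _%_; z≤n; s≤s)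
open import Data.Nat.DivMod using (m*n%n≡0; [m+kn]%n≡m%n; +-distrib-/; m<n⇒m/n≡0; m*n/n≡m; m<n⇒m%n≡m)
import Data.Nat.Properties as ℕₚ
open import Data.Fin using (zero; suc; toℕ; _↑ˡ_; _↑ʳ_; splitAt; punchIn; punchOut)
import Data.Fin.Properties as Finₚ
open import Data.Fin.Patterns using (0F; 1F; 2F; 3F)
open import Data.Fin.Permutation using (Permutation; permutation; _⟨$⟩ʳ_; ↔⇒≡)
open import Data.Bool using (Bool; true; false; _∧_; if_then_else_)
import Data.Bool.Properties as Boolₚ
open import Data.Sum using (_⊎_; inj₁; inj₂; [_,_]′)
open import Data.Vec.Functional using (_∷_; [])
import Data.List as List
open List using (List)
open import Induction.WellFounded using (Acc; acc)
open import Data.Nat.Induction using (<-wellFounded)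
open import Data.Product using (_,_; proj₁; proj₂)
open import Data.Unit using (⊤; tt)
open import Data.Empty using (⊥; ⊥-elim)
open import Relation.Nullary using (Dec; yes; no; _×-dec_; ¬?)
open import Relation.Nullary.Decidable using (toWitness; decidable-stable)
open import Relation.Binary.Definitions using (tri<; tri≈; tri>)
open import Relation.Binary.PropositionalEquality
  using (_≢_; ≢-sym; refl; sym; trans; cong; cong₂; subst; module ≡-Reasoning)
open import Function.Base using (id; _∘_)
open import Function.Bundles using (Equivalence; mk⇔)
open import Algebra.Properties.CommutativeMonoid.Sum ℕₚ.+-0-commutativeMonoid using (sum; sum-permute)
open import Algebra.Properties.CommutativeSemigroup ℕₚ.+-commutativeSemigroup using (interchange)

sum-cong : ∀ {n} {f g : Fin n → ℕ} → (∀ i → f i ≡ g i) → sumFin f ≡ sumFin g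
sum-cong {zero} e = refl
sum-cong {suc n} e = cong₂ _+_ (e zero) (sum-cong (λ i → e (suc i)))

sum-zero : ∀ n → sumFin {n} (λ _ → 0) ≡ 0
sum-zero zero = refl
sum-zero (suc n) = sum-zero n

sum-+ : ∀ {n} (f g : Fin n → ℕ) → sumFin (λ i → f i + g i) ≡ sumFin f + sumFin g
sum-+ {zero} f g = refl
sum-+ {suc n} f g = trans (cong (f zero + g zero +_) (sum-+ (λ i → f (suc i)) (λ i → g (suc i))))
                          (interchange (f zero) (g zero) _ _)

sum-swap : ∀ {m n} (f : Fin m → Fin n → ℕ) →
  sumFin (λ i → sumFin (f i)) ≡ sumFin (λ j → sumFin (λ i → f i j))
sum-swap {zero} {n} f = sym (sum-zero n)
sum-swap {suc m} f = trans (cong (sumFin (f zero) +_) (sum-swap (λ i → f (suc i))))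
                           (sym (sum-+ (f zero) _))

sum-split : ∀ a {b} (f : Fin (a + b) → ℕ) →
  sumFin f ≡ sumFin (λ i → f (i ↑ˡ b)) + sumFin (λ j → f (a ↑ʳ j))
sum-split zero f = refl
sum-split (suc a) f = trans (cong (f zero +_) (sum-split a (λ i → f (suc i))))
                            (sym (ℕₚ.+-assoc (f zero) _ _))

-- sumFin is the library's sum, which is invariant under reindexing by a permutation.
sumFin≡sum : ∀ {n} (f : Fin n → ℕ) → sumFin f ≡ sum f
sumFin≡sum {zero} f = refl
sumFin≡sum {suc n} f = cong (f zero +_) (sumFin≡sum (λ i → f (suc i)))

sum-reindex : ∀ {m n} (π : Permutation m n) (f : Fin n → ℕ) →
  sumFin f ≡ sumFin (λ i → f (π ⟨$⟩ʳ i))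
sum-reindex π f = trans (sumFin≡sum f) (trans (sum-permute f π) (sym (sumFin≡sum (λ i → f (π ⟨$⟩ʳ i)))))

sum-lower : ∀ {n} k (f : Fin n → ℕ) → (∀ i → k ≤ f i) → n * k ≤ sumFin f
sum-lower {zero} k f lo = z≤n
sum-lower {suc n} k f lo = ℕₚ.+-mono-≤ (lo zero) (sum-lower k (λ i → f (suc i)) (λ i → lo (suc i)))

bit : Bool → ℕ
bit b = if b then 1 else 0

orientedBit : ∀ {n} → Graph n → Fin n → Fin n → ℕ
orientedBit G i j = bit ((toℕ i <ᵇ toℕ j) ∧ G i j)

degree : ∀ {n} → Graph n → Fin n → ℕ
degree G i = sumFin (λ j → bit (G i j))

degreeSum : ∀ {n} → Graph n → ℕ
degreeSum G = sumFin (degree G)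

<ᵇ-true : ∀ {m n} → m < n → (m <ᵇ n) ≡ true
<ᵇ-true m<n = Equivalence.to Boolₚ.T-≡ (ℕₚ.<⇒<ᵇ m<n)

<ᵇ-false : ∀ {m n} → ¬ (m < n) → (m <ᵇ n) ≡ false
<ᵇ-false {m} {n} m≮n = Boolₚ.¬-not (λ eq → m≮n (ℕₚ.<ᵇ⇒< m n (Equivalence.from Boolₚ.T-≡ eq)))

bit-orient : ∀ {n} (G : Graph n) → IsSimple G → ∀ i j →
  bit (G i j) ≡ orientedBit G i j + orientedBit G j i
bit-orient G (sym-G , irr-G) i j with ℕₚ.<-cmp (toℕ i) (toℕ j)
... | tri< i<j _ j≮i rewrite <ᵇ-true i<j | <ᵇ-false j≮i = sym (ℕₚ.+-identityʳ _)
... | tri> i≮j _ j<i rewrite <ᵇ-true j<i | <ᵇ-false i≮j | sym-G j i = refl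
... | tri≈ i≮j i≡j _ rewrite Finₚ.toℕ-injective i≡j | <ᵇ-false i≮j | irr-G j = refl

double : ∀ x → 2 * x ≡ x + x
double x = cong (x +_) (ℕₚ.+-identityʳ x)

handshake : ∀ {n} (G : Graph n) → IsSimple G → degreeSum G ≡ edges G + edges G
handshake {n} G s = begin
  degreeSum G                                          ≡⟨ sum-cong (λ i → sum-cong (bit-orient G s i)) ⟩
  sumFin (λ i → sumFin (λ j → forward i j + backward i j))
    ≡⟨ sum-cong (λ i → sum-+ (forward i) (backward i)) ⟩
  sumFin (λ i → sumFin (forward i) + sumFin (backward i))
    ≡⟨ sum-+ (λ i → sumFin (forward i)) (λ i → sumFin (backward i)) ⟩
  edges G + sumFin (λ i → sumFin (backward i))         ≡⟨ cong (edges G +_) (sum-swap backward) ⟩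
  edges G + edges G                                    ∎
  where
  open ≡-Reasoning
  forward backward : Fin n → Fin n → ℕ
  forward i j = orientedBit G i j
  backward i j = orientedBit G j i

iso-refl : ∀ {n} {G : Graph n} → Iso G G
iso-refl = record { to = id ; from = id ; from-to = λ _ → refl ; to-from = λ _ → refl
                  ; preserve = λ _ _ → refl }

iso-empty : (G : Graph 0) → Iso G emptyG
iso-empty G = record { to = λ () ; from = λ () ; from-to = λ () ; to-from = λ () ; preserve = λ () }

iso-trans : ∀ {n m k} {G : Graph n} {H : Graph m} {K : Graph k} → Iso G H → Iso H K → Iso G K
iso-trans I J = record
  { to = λ i → J.to (I.to i) ; from = λ i → I.from (J.from i)
  ; from-to = λ i → trans (cong I.from (J.from-to (I.to i))) (I.from-to i)
  ; to-from = λ i → trans (cong J.to (I.to-from (J.from i))) (J.to-from i)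
  ; preserve = λ i j → trans (J.preserve (I.to i) (I.to j)) (I.preserve i j) }
  where module I = Iso I
        module J = Iso J

module _ {n m} {G : Graph n} {H : Graph m} (I : Iso G H) where
  open Iso I

  iso-permutation : Permutation n m
  iso-permutation = permutation to from to-from from-to

  iso-size : n ≡ m
  iso-size = ↔⇒≡ iso-permutation

  reflect : ∀ i j → G (from i) (from j) ≡ H i j
  reflect i j = trans (sym (preserve (from i) (from j))) (cong₂ H (to-from i) (to-from j))

  iso-simple : IsSimple G → IsSimple H
  iso-simple (sym-G , irr-G) = (λ i j → trans (sym (reflect i j)) (trans (sym-G _ _) (reflect j i)))
                             , (λ i → trans (sym (reflect i i)) (irr-G _))

  iso-degreeSum : degreeSum H ≡ degreeSum G
  iso-degreeSum = begin
    degreeSum H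
      ≡⟨ sum-reindex iso-permutation (degree H) ⟩
    sumFin (λ i → degree H (to i))
      ≡⟨ sum-cong (λ i → sum-reindex iso-permutation (λ j → bit (H (to i) j))) ⟩
    sumFin (λ i → sumFin (λ j → bit (H (to i) (to j))))
      ≡⟨ sum-cong (λ i → sum-cong (λ j → cong bit (preserve i j))) ⟩
    degreeSum G
      ∎
    where open ≡-Reasoning

  iso-edges : IsSimple G → edges G ≡ edges H
  iso-edges s = ℕₚ.*-cancelˡ-≡ (edges G) (edges H) 2 (begin
    2 * edges G       ≡⟨ double (edges G) ⟩
    edges G + edges G ≡⟨ sym (handshake G s) ⟩
    degreeSum G       ≡⟨ sym iso-degreeSum ⟩
    degreeSum H       ≡⟨ handshake H (iso-simple s) ⟩
    edges H + edges H ≡⟨ sym (double (edges H)) ⟩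
    2 * edges H       ∎)
    where open ≡-Reasoning

data Side (a b : ℕ) : Fin (a + b) → Set where
  left  : (x : Fin a) → Side a b (x ↑ˡ b)
  right : (y : Fin b) → Side a b (a ↑ʳ y)

side : ∀ a b (s : Fin (a + b)) → Side a b s
side zero b s = right s
side (suc a) b zero = left zero
side (suc a) b (suc s) with side a b s
... | left x = left (suc x)
... | right y = right y

module _ {a b} (A : Graph a) (B : Graph b) where
  ⊕-ll : ∀ x y → (A ⊕ B) (x ↑ˡ b) (y ↑ˡ b) ≡ A x y
  ⊕-ll x y rewrite Finₚ.splitAt-↑ˡ a x b | Finₚ.splitAt-↑ˡ a y b = refl

  ⊕-rr : ∀ x y → (A ⊕ B) (a ↑ʳ x) (a ↑ʳ y) ≡ B x y
  ⊕-rr x y rewrite Finₚ.splitAt-↑ʳ a b x | Finₚ.splitAt-↑ʳ a b y = refl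

  ⊕-lr : ∀ x y → (A ⊕ B) (x ↑ˡ b) (a ↑ʳ y) ≡ false
  ⊕-lr x y rewrite Finₚ.splitAt-↑ˡ a x b | Finₚ.splitAt-↑ʳ a b y = refl

  ⊕-rl : ∀ x y → (A ⊕ B) (a ↑ʳ x) (y ↑ˡ b) ≡ false
  ⊕-rl x y rewrite Finₚ.splitAt-↑ʳ a b x | Finₚ.splitAt-↑ˡ a y b = refl

<ᵇ-shift : ∀ a p q → ((a + p) <ᵇ (a + q)) ≡ (p <ᵇ q)
<ᵇ-shift zero p q = refl
<ᵇ-shift (suc a) p q = <ᵇ-shift a p q

edges-⊕ : ∀ {a b} (A : Graph a) (B : Graph b) → edges (A ⊕ B) ≡ edges A + edges B
edges-⊕ {a} {b} A B = begin
  edges (A ⊕ B)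
    ≡⟨ sum-split a _ ⟩
  sumFin (λ x → sumFin (e (x ↑ˡ b))) + sumFin (λ y → sumFin (e (a ↑ʳ y)))
    ≡⟨ cong₂ _+_ (sum-cong (λ x → sum-split a (e (x ↑ˡ b)))) (sum-cong (λ y → sum-split a (e (a ↑ʳ y)))) ⟩
  sumFin (λ x → sumFin (λ x' → e (x ↑ˡ b) (x' ↑ˡ b)) + sumFin (λ y' → e (x ↑ˡ b) (a ↑ʳ y')))
   + sumFin (λ y → sumFin (λ x' → e (a ↑ʳ y) (x' ↑ˡ b)) + sumFin (λ y' → e (a ↑ʳ y) (a ↑ʳ y')))
    ≡⟨ cong₂ _+_ (sum-cong (λ x → cong₂ _+_ (sum-cong (ll x)) (trans (sum-cong (lr x)) (sum-zero b))))
                 (sum-cong (λ y → cong₂ _+_ (trans (sum-cong (rl y)) (sum-zero a)) (sum-cong (rr y)))) ⟩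
  sumFin (λ x → sumFin (orientedBit A x) + 0) + sumFin (λ y → sumFin (orientedBit B y))
    ≡⟨ cong (_+ edges B) (sum-cong (λ x → ℕₚ.+-identityʳ (sumFin (orientedBit A x)))) ⟩
  edges A + edges B ∎
  where
  open ≡-Reasoning
  e : Fin (a + b) → Fin (a + b) → ℕ
  e = orientedBit (A ⊕ B)
  ll : ∀ x x' → e (x ↑ˡ b) (x' ↑ˡ b) ≡ orientedBit A x x'
  ll x x' rewrite Finₚ.toℕ-↑ˡ x b | Finₚ.toℕ-↑ˡ x' b | ⊕-ll A B x x' = refl
  rr : ∀ y y' → e (a ↑ʳ y) (a ↑ʳ y') ≡ orientedBit B y y'
  rr y y' rewrite Finₚ.toℕ-↑ʳ a y | Finₚ.toℕ-↑ʳ a y' | <ᵇ-shift a (toℕ y) (toℕ y') | ⊕-rr A B y y'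
    = refl
  lr : ∀ x y → e (x ↑ˡ b) (a ↑ʳ y) ≡ 0
  lr x y rewrite ⊕-lr A B x y | Boolₚ.∧-zeroʳ (toℕ (x ↑ˡ b) <ᵇ toℕ (a ↑ʳ y)) = refl
  rl : ∀ y x → e (a ↑ʳ y) (x ↑ˡ b) ≡ 0
  rl y x rewrite ⊕-rl A B y x | Boolₚ.∧-zeroʳ (toℕ (a ↑ʳ y) <ᵇ toℕ (x ↑ˡ b)) = refl

⊕-congʳ : ∀ {a b b'} (A : Graph a) {B : Graph b} {B' : Graph b'} → Iso B B' → Iso (A ⊕ B) (A ⊕ B')
⊕-congʳ {a} {b} {b'} A {B} {B'} I = record
  { to = mapʳ I.to ; from = mapʳ I.from ; from-to = from-to ; to-from = to-from ; preserve = preserve }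
  where
  module I = Iso I
  mapʳ : ∀ {c d} → (Fin c → Fin d) → Fin (a + c) → Fin (a + d)
  mapʳ {c} {d} g s with splitAt a s
  ... | inj₁ x = x ↑ˡ d
  ... | inj₂ y = a ↑ʳ g y
  mapʳ-l : ∀ {c d} (g : Fin c → Fin d) x → mapʳ g (x ↑ˡ c) ≡ x ↑ˡ d
  mapʳ-l {c} g x rewrite Finₚ.splitAt-↑ˡ a x c = refl
  mapʳ-r : ∀ {c d} (g : Fin c → Fin d) y → mapʳ g (a ↑ʳ y) ≡ a ↑ʳ g y
  mapʳ-r {c} g y rewrite Finₚ.splitAt-↑ʳ a c y = refl
  from-to : ∀ s → mapʳ I.from (mapʳ I.to s) ≡ s
  from-to s with side a b s
  ... | left x rewrite mapʳ-l I.to x | mapʳ-l I.from x = refl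
  ... | right y rewrite mapʳ-r I.to y | mapʳ-r I.from (I.to y) = cong (a ↑ʳ_) (I.from-to y)
  to-from : ∀ s → mapʳ I.to (mapʳ I.from s) ≡ s
  to-from s with side a b' s
  ... | left x rewrite mapʳ-l I.from x | mapʳ-l I.to x = refl
  ... | right y rewrite mapʳ-r I.from y | mapʳ-r I.to (I.from y) = cong (a ↑ʳ_) (I.to-from y)
  preserve : ∀ s t → (A ⊕ B') (mapʳ I.to s) (mapʳ I.to t) ≡ (A ⊕ B) s t
  preserve s t with side a b s | side a b t
  ... | left x | left x' rewrite mapʳ-l I.to x | mapʳ-l I.to x' | ⊕-ll A B' x x' | ⊕-ll A B x x' = refl
  ... | left x | right y rewrite mapʳ-l I.to x | mapʳ-r I.to y | ⊕-lr A B' x (I.to y) | ⊕-lr A B x y = refl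
  ... | right y | left x rewrite mapʳ-r I.to y | mapʳ-l I.to x | ⊕-rl A B' (I.to y) x | ⊕-rl A B y x = refl
  ... | right y | right y' rewrite mapʳ-r I.to y | mapʳ-r I.to y' | ⊕-rr A B' (I.to y) (I.to y') | ⊕-rr A B y y'
    = I.preserve y y'

IsEmbedding : ∀ {k n} → Graph k → Graph n → (Fin k → Fin n) → Set
IsEmbedding H G x = Injective _≡_ _≡_ x × (∀ a b → G (x a) (x b) ≡ H a b)

dropFirst : ∀ {k} → Graph (suc k) → Graph k
dropFirst H i j = H (suc i) (suc j)

dropFirst-simple : ∀ {k} {H : Graph (suc k)} → IsSimple H → IsSimple (dropFirst H)
dropFirst-simple (sym-H , irr-H) = (λ i j → sym-H (suc i) (suc j)) , (λ i → irr-H (suc i))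

Upper : ∀ {k n} → Graph k → Graph n → (Fin k → Fin n) → Set
Upper {zero} H G x = ⊤
Upper {suc k} H G x = (∀ i → x zero ≢ x (suc i) × G (x zero) (x (suc i)) ≡ H zero (suc i))
                    × Upper (dropFirst H) G (λ i → x (suc i))

upper⇒embedding : ∀ {k n} {H : Graph k} {G : Graph n} {x : Fin k → Fin n} →
  IsSimple G → IsSimple H → Upper H G x → IsEmbedding H G x
upper⇒embedding {zero} _ _ _ = (λ { {()} }) , (λ ())
upper⇒embedding {suc k} {H = H} {G} {x} (sym-G , irr-G) (sym-H , irr-H) (first , rest) =
  injective , preserves
  where
  tail-embedding : IsEmbedding (dropFirst H) G (λ i → x (suc i))
  tail-embedding = upper⇒embedding (sym-G , irr-G) (dropFirst-simple (sym-H , irr-H)) rest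
  injective : Injective _≡_ _≡_ x
  injective {zero} {zero} _ = refl
  injective {zero} {suc j} e = ⊥-elim (proj₁ (first j) e)
  injective {suc i} {zero} e = ⊥-elim (proj₁ (first i) (sym e))
  injective {suc i} {suc j} e = cong suc (proj₁ tail-embedding e)
  preserves : ∀ a b → G (x a) (x b) ≡ H a b
  preserves zero zero = trans (irr-G (x zero)) (sym (irr-H zero))
  preserves zero (suc j) = proj₂ (first j)
  preserves (suc i) zero = trans (sym-G _ _) (trans (proj₂ (first i)) (sym-H zero (suc i)))
  preserves (suc i) (suc j) = proj₂ tail-embedding i j

embedding-∘ : ∀ {k m n} {H : Graph k} {F : Graph m} {G : Graph n} {x : Fin k → Fin m} {e : Fin m → Fin n} →
  IsEmbedding F G e → IsEmbedding H F x → IsEmbedding H G (λ a → e (x a))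
embedding-∘ {x = x} (inj-e , pres-e) (inj-x , pres-x) =
  (λ eq → inj-x (inj-e eq)) , (λ a b → trans (pres-e (x a) (x b)) (pres-x a b))

simple? : ∀ {k} (H : Graph k) → Dec (IsSimple H)
simple? H = (Finₚ.all? λ i → Finₚ.all? λ j → H i j Boolₚ.≟ H j i)
      ×-dec Finₚ.all? (λ i → H i i Boolₚ.≟ false)

K13-simple : IsSimple K13
K13-simple = toWitness {a? = simple? K13} tt

K1-simple : IsSimple K1
K1-simple = toWitness {a? = simple? K1} tt

K3-simple : IsSimple K3
K3-simple = toWitness {a? = simple? K3} tt

P3-simple : IsSimple P3
P3-simple = toWitness {a? = simple? P3} tt

K2-simple : IsSimple K2
K2-simple = toWitness {a? = simple? K2} tt

P2-simple : IsSimple P2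
P2-simple = toWitness {a? = simple? P2} tt

C4-simple : IsSimple C4
C4-simple = toWitness {a? = simple? C4} tt

InImage : ∀ {k n} → (Fin k → Fin n) → Fin n → Set
InImage f y = ∃[ a ] f a ≡ y

Closed : ∀ {k n} → Graph n → (Fin k → Fin n) → Set
Closed G f = ∀ a y → G (f a) y ≡ true → InImage f y

record Core {n} (G : Graph n) : Set where
  field
    type      : CompType
    vertex    : Fin (csize type) → Fin n
    embedding : IsEmbedding (cgraph type) G vertex
    closed    : Closed G vertex

-- A core containing v; it will turn out to be the connected component of v.
Component : ∀ {n} → Graph n → Fin n → Set
Component G v = Σ (Core G) λ K → InImage (Core.vertex K) v

neighbour-component : ∀ {n} {G : Graph n} {w v} → G w v ≡ true → Component G w → Component G v
neighbour-component wv (K , (a , refl)) = K , Core.closed K a _ wv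

either : ∀ {k n} {x : Fin k → Fin n} {y} i j → y ≡ x i ⊎ y ≡ x j → InImage x y
either i j (inj₁ y≡xi) = i , sym y≡xi
either i j (inj₂ y≡xj) = j , sym y≡xj

cgraph-simple : ∀ c → IsSimple (cgraph c)
cgraph-simple cC4 = C4-simple
cgraph-simple cK1 = K1-simple
cgraph-simple cK2 = K2-simple
cgraph-simple cP2 = P2-simple

Forbidden : ∀ {n} → Graph n → Set
Forbidden G = ¬ Induced K13 G × ¬ Induced K3 G × ¬ Induced P3 G

module LocalStructure {n} (G : Graph n) (simple : IsSimple G) (forbidden : Forbidden G) where
  private
    sym-G : ∀ i j → G i j ≡ G j i
    sym-G = proj₁ simple
    irr-G : ∀ i → G i i ≡ false
    irr-G = proj₂ simple
    no-K13 : ¬ Induced K13 G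
    no-K13 = proj₁ forbidden
    no-K3 : ¬ Induced K3 G
    no-K3 = proj₁ (proj₂ forbidden)
    no-P3 : ¬ Induced P3 G
    no-P3 = proj₂ (proj₂ forbidden)

  Adj : Fin n → Fin n → Set
  Adj x y = G x y ≡ true

  adj≢ : ∀ {x y} → Adj x y → x ≢ y
  adj≢ {x} xy refl = Boolₚ.not-¬ (irr-G x) xy

  adj-sym : ∀ {x y} → Adj x y → Adj y x
  adj-sym {x} {y} xy = trans (sym-G y x) xy

  non-adj : ∀ {x y} → ¬ Adj x y → G x y ≡ false
  non-adj = Boolₚ.¬-not

  triangle-free : ∀ {a b c} → Adj a b → Adj b c → Adj a c → ⊥
  triangle-free {a} {b} {c} ab bc ac = no-K3 ((a ∷ b ∷ c ∷ []) ,
    upper⇒embedding simple K3-simple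
      ((λ { 0F → adj≢ ab , ab ; 1F → adj≢ ac , ac }) , (λ { 0F → adj≢ bc , bc }) , (λ ()) , tt))

  apart : ∀ {v w w'} → Adj v w → Adj v w' → G w w' ≡ false
  apart vw vw' = non-adj (λ ww' → triangle-free vw ww' vw')

  -- Triangle- and claw-freeness: no vertex has three distinct neighbours.
  claw-free : ∀ {v a b c} → Adj v a → Adj v b → Adj v c → a ≢ b → a ≢ c → b ≢ c → ⊥
  claw-free {v} {a} {b} {c} va vb vc a≢b a≢c b≢c with G a b in ab | G a c in ac | G b c in bc
  ... | true | _ | _ = triangle-free va ab vb
  ... | false | true | _ = triangle-free va ac vc
  ... | false | false | true = triangle-free vb bc vc
  ... | false | false | false = no-K13 ((v ∷ a ∷ b ∷ c ∷ []) ,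
    upper⇒embedding simple K13-simple
      ( (λ { 0F → adj≢ va , va ; 1F → adj≢ vb , vb ; 2F → adj≢ vc , vc })
      , (λ { 0F → a≢b , ab ; 1F → a≢c , ac }) , (λ { 0F → b≢c , bc }) , (λ ()) , tt))

  at-most-two : ∀ {v a b y} → Adj v a → Adj v b → a ≢ b → Adj v y → y ≡ a ⊎ y ≡ b
  at-most-two {y = y} va vb a≢b vy with y Finₚ.≟ _ | y Finₚ.≟ _
  ... | yes y≡a | _ = inj₁ y≡a
  ... | no _ | yes y≡b = inj₂ y≡b
  ... | no y≢a | no y≢b = ⊥-elim (claw-free va vb vy a≢b (≢-sym y≢a) (≢-sym y≢b))

  P3-free : ∀ {a b c d} → Adj a b → Adj b c → Adj c d →
    G a c ≡ false → G a d ≡ false → G b d ≡ false → a ≢ c → a ≢ d → b ≢ d → ⊥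
  P3-free {a} {b} {c} {d} ab bc cd ac ad bd a≢c a≢d b≢d = no-P3 ((a ∷ b ∷ c ∷ d ∷ []) ,
    upper⇒embedding simple P3-simple
      ( (λ { 0F → adj≢ ab , ab ; 1F → a≢c , ac ; 2F → a≢d , ad })
      , (λ { 0F → adj≢ bc , bc ; 1F → b≢d , bd }) , (λ { 0F → adj≢ cd , cd }) , (λ ()) , tt))

  some-neighbour : ∀ x → (∃[ y ] Adj x y) ⊎ (∀ y → ¬ Adj x y)
  some-neighbour x with Finₚ.any? (λ y → G x y Boolₚ.≟ true)
  ... | yes found = inj₁ found
  ... | no none = inj₂ (λ y xy → none (y , xy))

  another-neighbour : ∀ x a → (∃[ y ] Adj x y × y ≢ a) ⊎ (∀ y → Adj x y → y ≡ a)
  another-neighbour x a with Finₚ.any? (λ y → (G x y Boolₚ.≟ true) ×-dec ¬? (y Finₚ.≟ a))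
  ... | yes found = inj₁ found
  ... | no none = inj₂ (λ y xy → decidable-stable (y Finₚ.≟ a) (λ y≢a → none (y , xy , y≢a)))

  isolated : ∀ {v} → (∀ y → ¬ Adj v y) → Component G v
  isolated {v} none = record { type = cK1 ; vertex = λ _ → v
    ; embedding = upper⇒embedding simple K1-simple ((λ ()) , tt)
    ; closed = λ _ y vy → ⊥-elim (none y vy) } , (0F , refl)

  edge : ∀ {v w} → Adj v w → (∀ y → Adj v y → y ≡ w) → (∀ y → Adj w y → y ≡ v) → Component G v
  edge {v} {w} vw only-w only-v = record { type = cK2 ; vertex = v ∷ w ∷ []
    ; embedding = upper⇒embedding simple K2-simple ((λ { 0F → adj≢ vw , vw }) , (λ ()) , tt)
    ; closed = λ { 0F y vy → 1F , sym (only-w y vy) ; 1F y wy → 0F , sym (only-v y wy) } }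
    , (0F , refl)

  path : ∀ {v w w'} → Adj v w → Adj v w' → w ≢ w' →
    (∀ y → Adj w y → y ≡ v) → (∀ y → Adj w' y → y ≡ v) → Component G v
  path {v} {w} {w'} vw vw' w≢w' only-v only-v' = record { type = cP2 ; vertex = w ∷ v ∷ w' ∷ []
    ; embedding = upper⇒embedding simple P2-simple
        ( (λ { 0F → adj≢ (adj-sym vw) , adj-sym vw ; 1F → w≢w' , apart vw vw' })
        , (λ { 0F → adj≢ vw' , vw' }) , (λ ()) , tt)
    ; closed = λ { 0F y wy → 1F , sym (only-v y wy)
                 ; 1F y vy → either 0F 2F (at-most-two vw vw' w≢w' vy)
                 ; 2F y w'y → 1F , sym (only-v' y w'y) } }
    , (1F , refl)

  -- v has exactly the neighbours w, w', and w has a further neighbour x.  Then x ~ w'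
  -- and v w x w' is a 4-cycle component, for otherwise x w v w' is an induced P3.
  square : ∀ {v w w' x} → Adj v w → Adj v w' → w ≢ w' → Adj w x → x ≢ v → Component G v
  square {v} {w} {w'} {x} vw vw' w≢w' wx x≢v = close (G w' x) refl
    where
    v≢x : v ≢ x
    v≢x = ≢-sym x≢v
    x≢w' : x ≢ w'
    x≢w' refl = Boolₚ.not-¬ (apart vw vw') wx
    vx : G v x ≡ false
    vx = non-adj (λ vx' → [ adj≢ wx ∘ sym , x≢w' ]′ (at-most-two vw vw' w≢w' vx'))
    close : ∀ b → G w' x ≡ b → Component G v
    close true w'x = record { type = cC4 ; vertex = v ∷ w ∷ x ∷ w' ∷ []
      ; embedding = upper⇒embedding simple C4-simple
          ( (λ { 0F → adj≢ vw , vw ; 1F → v≢x , vx ; 2F → adj≢ vw' , vw' })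
          , (λ { 0F → adj≢ wx , wx ; 1F → w≢w' , apart vw vw' })
          , (λ { 0F → x≢w' , adj-sym w'x }) , (λ ()) , tt)
      ; closed = λ
          { 0F y vy → either 1F 3F (at-most-two vw vw' w≢w' vy)
          ; 1F y wy → either 0F 2F (at-most-two (adj-sym vw) wx v≢x wy)
          ; 2F y xy →
              either 1F 3F (at-most-two (adj-sym wx) (adj-sym w'x) w≢w' xy)
          ; 3F y w'y →
              either 0F 2F (at-most-two (adj-sym vw') w'x v≢x w'y) } }
      , (0F , refl)
    close false w'x = ⊥-elim (P3-free (adj-sym wx) (adj-sym vw) vw'
      (trans (sym-G x v) vx) (trans (sym-G x w') w'x) (apart vw vw') x≢v x≢w' w≢w')

  middle : ∀ {v w w'} → Adj v w → Adj v w' → w ≢ w' → Component G v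
  middle {v} {w} {w'} vw vw' w≢w' with another-neighbour w v
  ... | inj₁ (x , wx , x≢v) = square vw vw' w≢w' wx x≢v
  ... | inj₂ only-v with another-neighbour w' v
  ...   | inj₁ (x , w'x , x≢v) = square vw' vw (≢-sym w≢w') w'x x≢v
  ...   | inj₂ only-v' = path vw vw' w≢w' only-v only-v'

  -- Classification by the neighbourhood of v: no neighbour gives K1; two neighbours are handled
  -- by middle; a single neighbour w either has no other neighbour (K2) or has two, and then v
  -- lies in the component of w.
  classify : ∀ v → Component G v
  classify v with some-neighbour v
  ... | inj₂ none = isolated none
  ... | inj₁ (w , vw) with another-neighbour v w
  ...   | inj₁ (w' , vw' , w'≢w) = middle vw vw' (≢-sym w'≢w)
  ...   | inj₂ only-w with another-neighbour w v
  ...     | inj₁ (x , wx , x≢v) = neighbour-component (adj-sym vw) (middle (adj-sym vw) wx (≢-sym x≢v))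
  ...     | inj₂ only-v = edge vw only-w only-v

reach-trans : ∀ {n} {G : Graph n} {a b c} → Reach G a b → Reach G b c → Reach G a c
reach-trans here r = r
reach-trans (step e r) r' = step e (reach-trans r r')

reach-sym : ∀ {n} {G : Graph n} → (∀ i j → G i j ≡ G j i) → ∀ {a b} → Reach G a b → Reach G b a
reach-sym sym-G here = here
reach-sym sym-G (step e r) = reach-trans (reach-sym sym-G r) (step (trans (sym-G _ _) e) here)

first : ∀ c → Fin (csize c)
first cC4 = 0F
first cK1 = 0F
first cK2 = 0F
first cP2 = 0F

to-first : ∀ c (a : Fin (csize c)) → Reach (cgraph c) a (first c)
to-first cC4 0F = here
to-first cC4 1F = step refl here
to-first cC4 2F = step {w = 1F} refl (step refl here)
to-first cC4 3F = step refl here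
to-first cK1 0F = here
to-first cK2 0F = here
to-first cK2 1F = step refl here
to-first cP2 0F = here
to-first cP2 1F = step refl here
to-first cP2 2F = step {w = 1F} refl (step refl here)

connected : ∀ c (a b : Fin (csize c)) → Reach (cgraph c) a b
connected c a b = reach-trans (to-first c a) (reach-sym (proj₁ (cgraph-simple c)) (to-first c b))

reach-map : ∀ {k n} {H : Graph k} {G : Graph n} {f : Fin k → Fin n} →
  (∀ a b → G (f a) (f b) ≡ H a b) → ∀ {a b} → Reach H a b → Reach G (f a) (f b)
reach-map pres here = here
reach-map pres (step {w = w} e r) = step (trans (pres _ w) e) (reach-map pres r)

reach-closed : ∀ {k n} {G : Graph n} {f : Fin k → Fin n} → Closed G f →
  ∀ {x u} → Reach G x u → InImage f x → InImage f u
reach-closed closed here x∈f = x∈f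
reach-closed closed (step {w = w} e r) (a , refl) = reach-closed closed r (closed a w e)

component-reach : ∀ {n} {G : Graph n} {v} ((K , _) : Component G v) →
  ∀ u → Reach G v u ⇔ InImage (Core.vertex K) u
component-reach (K , (a , refl)) u =
  mk⇔ (λ r → reach-closed closed r (a , refl))
      (λ { (b , refl) → reach-map (proj₂ embedding) (connected type a b) })
  where open Core K

term≤sum : ∀ {n} (f : Fin n → ℕ) i → f i ≤ sumFin f
term≤sum f zero = ℕₚ.m≤m+n (f zero) _
term≤sum f (suc i) = ℕₚ.≤-trans (term≤sum (λ j → f (suc j)) i) (ℕₚ.m≤n+m _ (f zero))

sum-two : ∀ {n} (f : Fin n → ℕ) {y z} → y ≢ z → 1 ≤ f y → 1 ≤ f z → 2 ≤ sumFin f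
sum-two f {zero} {zero} y≢z _ _ = ⊥-elim (y≢z refl)
sum-two f {zero} {suc z} _ fy fz = ℕₚ.+-mono-≤ fy (ℕₚ.≤-trans fz (term≤sum (λ j → f (suc j)) z))
sum-two f {suc y} {zero} _ fy fz = ℕₚ.+-mono-≤ fz (ℕₚ.≤-trans fy (term≤sum (λ j → f (suc j)) y))
sum-two f {suc y} {suc z} y≢z fy fz =
  ℕₚ.≤-trans (sum-two (λ j → f (suc j)) (y≢z ∘ cong suc) fy fz) (ℕₚ.m≤n+m _ (f zero))

one≤bit : ∀ {b} → b ≡ true → 1 ≤ bit b
one≤bit refl = s≤s z≤n

C4-two-neighbours : ∀ a → ∃[ b ] ∃[ c ] b ≢ c × C4 a b ≡ true × C4 a c ≡ true
C4-two-neighbours = toWitness {a? = Finₚ.all? λ a → Finₚ.any? λ b → Finₚ.any? λ c →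
  ¬? (b Finₚ.≟ c) ×-dec (C4 a b Boolₚ.≟ true) ×-dec (C4 a c Boolₚ.≟ true)} tt

C4-degree : ∀ {n} {G : Graph n} {v} ((K , _) : Component G v) → Core.type K ≡ cC4 → 2 ≤ degree G v
C4-degree {G = G} (record { type = cC4 ; vertex = f ; embedding = (inj , pres) } , (a , refl)) refl =
  let (b , c , b≢c , ab , ac) = C4-two-neighbours a in
  sum-two (λ j → bit (G (f a) j)) (b≢c ∘ inj) (one≤bit (trans (pres a b) ab)) (one≤bit (trans (pres a c) ac))

min-degree-two : ∀ {n} (G : Graph n) → IsSimple G → (∀ v → 2 ≤ degree G v) → n ≤ edges G
min-degree-two {n} G s deg2 = ℕₚ.*-cancelˡ-≤ 2 (begin
  2 * n             ≡⟨ ℕₚ.*-comm 2 n ⟩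
  n * 2             ≤⟨ sum-lower 2 (degree G) deg2 ⟩
  degreeSum G       ≡⟨ handshake G s ⟩
  edges G + edges G ≡⟨ sym (double (edges G)) ⟩
  2 * edges G       ∎)
  where open ℕₚ.≤-Reasoning

record Extension {k n} (f : Fin k → Fin n) : Set where
  field
    m       : ℕ
    σ       : Fin (k + m) → Fin n
    σ⁻¹     : Fin n → Fin (k + m)
    σ⁻¹∘σ   : ∀ s → σ⁻¹ (σ s) ≡ s
    σ∘σ⁻¹   : ∀ x → σ (σ⁻¹ x) ≡ x
    extends : ∀ i → σ (i ↑ˡ m) ≡ f i

-- Induction on k: send 0 to f 0 and extend the injection punchOut ∘ f ∘ suc into Fin n.
extend : ∀ {k n} (f : Fin k → Fin n) → Injective _≡_ _≡_ f → Extension f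
extend {zero} {n} f _ = record { m = n ; σ = id ; σ⁻¹ = id ; σ⁻¹∘σ = λ _ → refl ; σ∘σ⁻¹ = λ _ → refl
                               ; extends = λ () }
extend {suc k} {zero} f _ with f zero
... | ()
extend {suc k} {suc n} f inj =
  record { m = E.m ; σ = σ ; σ⁻¹ = σ⁻¹ ; σ⁻¹∘σ = σ⁻¹∘σ ; σ∘σ⁻¹ = σ∘σ⁻¹ ; extends = extends }
  where
  u : Fin (suc n)
  u = f zero
  u≢ : ∀ i → u ≢ f (suc i)
  u≢ i e with inj e
  ... | ()
  f' : Fin k → Fin n
  f' i = punchOut (u≢ i)
  f'-injective : Injective _≡_ _≡_ f'
  f'-injective {i} {j} e = Finₚ.suc-injective (inj (Finₚ.punchOut-injective (u≢ i) (u≢ j) e))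
  module E = Extension (extend f' f'-injective)
  σ : Fin (suc k + E.m) → Fin (suc n)
  σ zero = u
  σ (suc t) = punchIn u (E.σ t)
  σ⁻¹ : Fin (suc n) → Fin (suc k + E.m)
  σ⁻¹ x with u Finₚ.≟ x
  ... | yes _ = zero
  ... | no u≢x = suc (E.σ⁻¹ (punchOut u≢x))
  σ⁻¹∘σ : ∀ s → σ⁻¹ (σ s) ≡ s
  σ⁻¹∘σ zero with u Finₚ.≟ u
  ... | yes _ = refl
  ... | no u≢u = ⊥-elim (u≢u refl)
  σ⁻¹∘σ (suc t) with u Finₚ.≟ punchIn u (E.σ t)
  ... | yes e = ⊥-elim (Finₚ.punchInᵢ≢i u (E.σ t) (sym e))
  ... | no _ = cong suc (trans (cong E.σ⁻¹ (trans (Finₚ.punchOut-cong u refl) (Finₚ.punchOut-punchIn u)))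
                               (E.σ⁻¹∘σ t))
  σ∘σ⁻¹ : ∀ x → σ (σ⁻¹ x) ≡ x
  σ∘σ⁻¹ x with u Finₚ.≟ x
  ... | yes e = e
  ... | no u≢x = trans (cong (punchIn u) (E.σ∘σ⁻¹ (punchOut u≢x))) (Finₚ.punchIn-punchOut u≢x)
  extends : ∀ i → σ (i ↑ˡ E.m) ≡ f i
  extends zero = refl
  extends (suc i) = trans (cong (punchIn u) (E.extends i)) (Finₚ.punchIn-punchOut (u≢ i))

↑ˡ≢↑ʳ : ∀ {k m} (b : Fin k) (y : Fin m) → b ↑ˡ m ≢ k ↑ʳ y
↑ˡ≢↑ʳ {suc k} zero y ()
↑ˡ≢↑ʳ {suc k} (suc b) y e = ↑ˡ≢↑ʳ b y (Finₚ.suc-injective e)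

-- G ≅ H ⊕ rest, where rest is the subgraph induced on the vertices outside the copy of H.
record Split {n k} (G : Graph n) (H : Graph k) : Set where
  field
    m              : ℕ
    rest           : Graph m
    iso            : Iso G (H ⊕ rest)
    inclusion      : Fin m → Fin n
    rest-embedding : IsEmbedding rest G inclusion

-- Splitting G along a closed induced copy of H: the bijection extending its embedding.
split : ∀ {n k} {G : Graph n} {H : Graph k} → IsSimple G →
  (f : Fin k → Fin n) → IsEmbedding H G f → Closed G f → Split G H
split {n} {k} {G} {H} (sym-G , _) f (inj , pres) closed = record
  { m = m ; rest = rest ; iso = iso ; inclusion = inclusion ; rest-embedding = inclusion-injective , (λ _ _ → refl) }
  where
  open Extension (extend f inj)
  inclusion : Fin m → Fin n
  inclusion y = σ (k ↑ʳ y)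
  rest : Graph m
  rest x y = G (inclusion x) (inclusion y)
  σ-injective : ∀ {s t} → σ s ≡ σ t → s ≡ t
  σ-injective {s} {t} e = trans (sym (σ⁻¹∘σ s)) (trans (cong σ⁻¹ e) (σ⁻¹∘σ t))
  inclusion-injective : Injective _≡_ _≡_ inclusion
  inclusion-injective {x} {y} e = Finₚ.↑ʳ-injective k x y (σ-injective e)
  -- Closedness: no edge joins the copy of H to the rest.
  no-cross : ∀ x y → G (f x) (inclusion y) ≡ false
  no-cross x y = Boolₚ.¬-not λ e →
    let (b , fb≡) = closed x _ e in ↑ˡ≢↑ʳ b y (σ-injective (trans (extends b) fb≡))
  preserve : ∀ s t → (H ⊕ rest) s t ≡ G (σ s) (σ t)
  preserve s t with side k m s | side k m t
  ... | left x | left x' rewrite ⊕-ll H rest x x' | extends x | extends x' = sym (pres x x')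
  ... | left x | right y rewrite ⊕-lr H rest x y | extends x = sym (no-cross x y)
  ... | right y | left x rewrite ⊕-rl H rest y x | extends x = sym (trans (sym-G _ _) (no-cross x y))
  ... | right y | right y' rewrite ⊕-rr H rest y y' = refl
  iso : Iso G (H ⊕ rest)
  iso = record { to = σ⁻¹ ; from = σ ; from-to = σ∘σ⁻¹ ; to-from = σ⁻¹∘σ
               ; preserve = λ i j → trans (preserve (σ⁻¹ i) (σ⁻¹ j)) (cong₂ G (σ∘σ⁻¹ i) (σ∘σ⁻¹ j))
               }

embedding-simple : ∀ {m n} {F : Graph m} {G : Graph n} {e : Fin m → Fin n} →
  IsSimple G → IsEmbedding F G e → IsSimple F
embedding-simple {e = e} (sym-G , irr-G) (_ , pres) =
    (λ a b → trans (sym (pres a b)) (trans (sym-G (e a) (e b)) (pres b a)))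
  , (λ a → trans (sym (pres a a)) (irr-G (e a)))

forbidden-inherit : ∀ {m n} {F : Graph m} {G : Graph n} {e : Fin m → Fin n} →
  IsEmbedding F G e → Forbidden G → Forbidden F
forbidden-inherit {G = G} emb (no-K13 , no-K3 , no-P3) =
  (λ (x , ex) → no-K13 (_ , embedding-∘ {G = G} emb ex)) ,
  (λ (x , ex) → no-K3 (_ , embedding-∘ {G = G} emb ex)) ,
  (λ (x , ex) → no-P3 (_ , embedding-∘ {G = G} emb ex))

totalSize : List CompType → ℕ
totalSize List.[] = 0
totalSize (c List.∷ cs) = csize c + totalSize cs

union : (cs : List CompType) → Graph (totalSize cs)
union List.[] = emptyG
union (c List.∷ cs) = cgraph c ⊕ union cs

componentType : ∀ {n} (G : Graph n) → IsSimple G → Forbidden G → Fin n → CompType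
componentType G s F v = Core.type (proj₁ (LocalStructure.classify G s F v))

-- Components are nonempty, so splitting one off shrinks the graph.
csize-pos : ∀ c → 0 < csize c
csize-pos cC4 = s≤s z≤n
csize-pos cK1 = s≤s z≤n
csize-pos cK2 = s≤s z≤n
csize-pos cP2 = s≤s z≤n

-- Split off the component of a chosen vertex and decompose the rest, by well-founded
-- recursion on the number of vertices.
mutual
  decompose : ∀ {n} → Acc _<_ n → (G : Graph n) → IsSimple G → Forbidden G →
    Σ (List CompType) λ cs → Iso G (union cs)
  decompose {zero} _ G _ _ = List.[] , iso-empty G
  decompose {suc n} rec G s F = let (cs , I) = decomposeFrom rec G s F zero in componentType G s F zero List.∷ cs , I

  decomposeFrom : ∀ {n} → Acc _<_ n → (G : Graph n) (s : IsSimple G) (F : Forbidden G) (v : Fin n) →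
    Σ (List CompType) λ cs → Iso G (union (componentType G s F v List.∷ cs))
  decomposeFrom {n} (acc rec) G s F v = proj₁ rest , iso-trans S.iso (⊕-congʳ (cgraph (Core.type K)) (proj₂ rest))
    where
    K : Core G
    K = proj₁ (LocalStructure.classify G s F v)
    module S = Split (split s (Core.vertex K) (Core.embedding K) (Core.closed K))
    smaller : S.m < n
    smaller = subst (S.m <_) (sym (iso-size S.iso)) (ℕₚ.m<n+m S.m (csize-pos (Core.type K)))
    rest : Σ (List CompType) λ cs → Iso S.rest (union cs)
    rest = decompose (rec smaller) S.rest (embedding-simple {G = G} s S.rest-embedding)
                     (forbidden-inherit {G = G} S.rest-embedding F)

-- The number of missing edges: C4 has as many edges as vertices, the others one fewer.
defect : CompType → ℕ
defect cC4 = 0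
defect cK1 = 1
defect cK2 = 1
defect cP2 = 1

edges+defect : ∀ c → edges (cgraph c) + defect c ≡ csize c
edges+defect cC4 = refl
edges+defect cK1 = refl
edges+defect cK2 = refl
edges+defect cP2 = refl

totalDefect : List CompType → ℕ
totalDefect List.[] = 0
totalDefect (c List.∷ cs) = defect c + totalDefect cs

union-count : ∀ cs → edges (union cs) + totalDefect cs ≡ totalSize cs
union-count List.[] = refl
union-count (c List.∷ cs) = begin
  edges (cgraph c ⊕ union cs) + (defect c + totalDefect cs)
    ≡⟨ cong (_+ (defect c + totalDefect cs)) (edges-⊕ (cgraph c) (union cs)) ⟩
  (edges (cgraph c) + edges (union cs)) + (defect c + totalDefect cs)
    ≡⟨ interchange (edges (cgraph c)) (edges (union cs)) (defect c) (totalDefect cs) ⟩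
  (edges (cgraph c) + defect c) + (edges (union cs) + totalDefect cs)
    ≡⟨ cong₂ _+_ (edges+defect c) (union-count cs) ⟩
  csize c + totalSize cs ∎
  where open ≡-Reasoning

count : ∀ {n} {G : Graph n} {cs} → IsSimple G → Iso G (union cs) → edges G + totalDefect cs ≡ n
count {cs = cs} s I =
  trans (cong (_+ totalDefect cs) (iso-edges I s)) (trans (union-count cs) (sym (iso-size I)))

defect-free : ∀ cs → totalDefect cs ≡ 0 → Iso (union cs) (copies (List.length cs) C4)
defect-free List.[] _ = iso-refl
defect-free (cC4 List.∷ cs) d≡0 = ⊕-congʳ C4 (defect-free cs d≡0)
defect-free (cK1 List.∷ cs) ()
defect-free (cK2 List.∷ cs) ()
defect-free (cP2 List.∷ cs) ()

h-divisible : ∀ n → n % 4 ≡ 0 → h n ≡ suc n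
h-divisible n n%4≡0 rewrite n%4≡0 = refl

h-indivisible : ∀ n r → n % 4 ≡ suc r → h n ≡ n
h-indivisible n r n%4≡ rewrite n%4≡ = refl

edges-copies : ∀ q → edges (copies q C4) ≡ q * 4
edges-copies zero = refl
edges-copies (suc q) = trans (edges-⊕ C4 (copies q C4)) (cong (4 +_) (edges-copies q))

h-shape : ∀ J q → h (jsize J + q * 4) ∸ 1 ≡ edges (jgraph J) + q * 4
h-shape jE q = cong (_∸ 1) (h-divisible (q * 4) (m*n%n≡0 q 4))
h-shape jK1 q = cong (_∸ 1) (h-indivisible (1 + q * 4) 0 ([m+kn]%n≡m%n 1 q 4))
h-shape jK2 q = cong (_∸ 1) (h-indivisible (2 + q * 4) 1 ([m+kn]%n≡m%n 2 q 4))
h-shape jP2 q = cong (_∸ 1) (h-indivisible (3 + q * 4) 2 ([m+kn]%n≡m%n 3 q 4))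

-- Since |J| < 4, the number of 4-cycles in J ⊕ q C4 is determined by the order: q = n / 4.
quotient : ∀ r q → r < 4 → (r + q * 4) / 4 ≡ q
quotient r q r<4 = trans (+-distrib-/ r (q * 4) small) (cong₂ _+_ (m<n⇒m/n≡0 r<4) (m*n/n≡m q 4))
  where
  small : r % 4 + (q * 4) % 4 < 4
  small = subst (_< 4) (sym (trans (cong₂ _+_ (m<n⇒m%n≡m r<4) (m*n%n≡0 q 4)) (ℕₚ.+-identityʳ r))) r<4

normalise : ∀ {n} {G : Graph n} J q → jsize J < 4 →
  Iso G (jgraph J ⊕ copies q C4) → Iso G (jgraph J ⊕ copies (n / 4) C4)
normalise {G = G} J q small I =
  subst (λ p → Iso G (jgraph J ⊕ copies p C4)) (sym (trans (cong (_/ 4) (iso-size I)) (quotient (jsize J) q small))) I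

cycles-divisible : ∀ {n} {G : Graph n} q → Iso G (copies q C4) → n % 4 ≡ 0
cycles-divisible q I = trans (cong (_% 4) (iso-size I)) (m*n%n≡0 q 4)

as-J : ∀ {n b} {G : Graph n} {X : Graph b} c → c ≢ cC4 → Iso G (cgraph c ⊕ X) →
  Σ JType λ J → jsize J < 4 × Iso G (jgraph J ⊕ X)
as-J cC4 c≢C4 _ = ⊥-elim (c≢C4 refl)
as-J cK1 _ I = jK1 , s≤s (s≤s z≤n) , I
as-J cK2 _ I = jK2 , s≤s (s≤s (s≤s z≤n)) , I
as-J cP2 _ I = jP2 , s≤s (s≤s (s≤s (s≤s z≤n))) , I

isC4? : ∀ c → Dec (c ≡ cC4)
isC4? cC4 = yes refl
isC4? cK1 = no (λ ())
isC4? cK2 = no (λ ())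
isC4? cP2 = no (λ ())

shape-extremal : ∀ {n} (G : Graph n) → IsSimple G →
  ∃[ J ] Iso G (jgraph J ⊕ copies (n / 4) C4) → edges G ≡ h n ∸ 1
shape-extremal {n} G s (J , I) = begin
  edges G                                  ≡⟨ iso-edges I s ⟩
  edges (jgraph J ⊕ copies q C4)           ≡⟨ edges-⊕ (jgraph J) (copies q C4) ⟩
  edges (jgraph J) + edges (copies q C4)   ≡⟨ cong (edges (jgraph J) +_) (edges-copies q) ⟩
  edges (jgraph J) + q * 4                 ≡⟨ sym (h-shape J q) ⟩
  h (jsize J + q * 4) ∸ 1                  ≡⟨ cong (λ p → h p ∸ 1) (sym (iso-size I)) ⟩
  h n ∸ 1                                  ∎
  where
  open ≡-Reasoning
  q : ℕ
  q = n / 4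

defect-non-C4 : ∀ c → c ≢ cC4 → defect c ≡ 1
defect-non-C4 cC4 c≢C4 = ⊥-elim (c≢C4 refl)
defect-non-C4 cK1 _ = refl
defect-non-C4 cK2 _ = refl
defect-non-C4 cP2 _ = refl

pred-below : ∀ {n} → 1 ≤ n → ¬ (n ≤ n ∸ 1)
pred-below {suc m} _ = ℕₚ.n≮n m

pred-balance : ∀ {n d} → 1 ≤ n → n ∸ 1 + suc d ≡ n → d ≡ 0
pred-balance {suc m} {d} _ eq = ℕₚ.+-cancelˡ-≡ m d 0
  (ℕₚ.suc-injective (trans (sym (ℕₚ.+-suc m d)) (trans eq (cong suc (sym (ℕₚ.+-identityʳ m))))))

module Extremal {n} (G : Graph n) (s : IsSimple G) (F : Forbidden G) where
  parts : Σ (List CompType) λ cs → Iso G (union cs)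
  parts = decompose (<-wellFounded n) G s F

  cs : List CompType
  cs = proj₁ parts

  balance : edges G + totalDefect cs ≡ n
  balance = count {cs = cs} s (proj₂ parts)

  defect-positive : ∀ r → n % 4 ≡ suc r → 1 ≤ totalDefect cs
  defect-positive r n%4≡ = ℕₚ.n≢0⇒n>0 λ d≡0 →
    0≢suc (trans (sym (cycles-divisible (List.length cs) (iso-trans (proj₂ parts) (defect-free cs d≡0)))) n%4≡)
    where
    0≢suc : 0 ≢ suc r
    0≢suc ()

  -- e(G) ≤ h(n) - 1: if 4 ∤ n the defect is positive.
  edge-bound : edges G ≤ h n ∸ 1
  edge-bound = bound (n % 4) refl
    where
    bound : ∀ r → n % 4 ≡ r → edges G ≤ h n ∸ 1
    bound zero n%4≡0 rewrite h-divisible n n%4≡0 = subst (edges G ≤_) balance (ℕₚ.m≤m+n _ _)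
    bound (suc r) n%4≡ rewrite h-indivisible n r n%4≡ = ℕₚ.m+n≤o⇒m≤o∸n (edges G)
      (subst (edges G + 1 ≤_) balance (ℕₚ.+-monoʳ-≤ (edges G) (defect-positive r n%4≡)))

  -- Case 4 ∣ n: e(G) = n forces every component to be a C4.
  extremal-divisible : edges G ≡ n → ∃[ J ] Iso G (jgraph J ⊕ copies (n / 4) C4)
  extremal-divisible e = jE , normalise jE (List.length cs) (s≤s z≤n)
                                 (iso-trans (proj₂ parts) (defect-free cs no-defect))
    where
    no-defect : totalDefect cs ≡ 0
    no-defect = ℕₚ.+-cancelˡ-≡ n _ 0
      (trans (cong (_+ totalDefect cs) (sym e)) (trans balance (sym (ℕₚ.+-identityʳ n))))

  -- Case 4 ∤ n: e(G) = n - 1.  Not every vertex has degree two (that would give n edges), so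
  -- some vertex v lies in a component c other than C4; splitting c off first, the rest has
  -- no defect left and consists of 4-cycles.
  extremal-indivisible : 1 ≤ n → edges G ≡ n ∸ 1 → ∃[ J ] Iso G (jgraph J ⊕ copies (n / 4) C4)
  extremal-indivisible 1≤n e with Finₚ.any? (λ v → ¬? (isC4? (componentType G s F v)))
  ... | no all-C4 = ⊥-elim (pred-below 1≤n (subst (n ≤_) e (min-degree-two G s degree-two)))
    where
    degree-two : ∀ v → 2 ≤ degree G v
    degree-two v = C4-degree (LocalStructure.classify G s F v)
      (decidable-stable (isC4? _) (λ not-C4 → all-C4 (v , not-C4)))
  ... | yes (v , not-C4) with decomposeFrom (<-wellFounded n) G s F v
  ...   | cs' , I with as-J (componentType G s F v) not-C4 I
  ...     | J , small , I' =
    J , normalise J (List.length cs') small (iso-trans I' (⊕-congʳ (jgraph J) (defect-free cs' no-defect)))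
    where
    c : CompType
    c = componentType G s F v
    no-defect : totalDefect cs' ≡ 0
    no-defect = pred-balance 1≤n (trans
      (cong₂ _+_ (sym e) (cong (_+ totalDefect cs') (sym (defect-non-C4 c not-C4))))
      (count {cs = c List.∷ cs'} s I))

  extremal-structure : 1 ≤ n → edges G ≡ h n ∸ 1 → ∃[ J ] Iso G (jgraph J ⊕ copies (n / 4) C4)
  extremal-structure 1≤n e = shape (n % 4) refl
    where
    shape : ∀ r → n % 4 ≡ r → ∃[ J ] Iso G (jgraph J ⊕ copies (n / 4) C4)
    shape zero n%4≡0 = extremal-divisible (trans e (cong (_∸ 1) (h-divisible n n%4≡0)))
    shape (suc r) n%4≡ = extremal-indivisible 1≤n (trans e (cong (_∸ 1) (h-indivisible n r n%4≡)))

component-structure : ∀ {n} (G : Graph n) → IsSimple G → Forbidden G → (v : Fin n) →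
  ∃[ c ] Σ (Fin (csize c) → Fin n) λ f → Injective _≡_ _≡_ f × (∀ a b → G (f a) (f b) ≡ cgraph c a b)
    × (∀ u → (Reach G v u ⇔ (∃[ a ] f a ≡ u)))
component-structure G s F v = type , vertex , proj₁ embedding , proj₂ embedding , component-reach C
  where
  C : Component G v
  C = LocalStructure.classify G s F v
  open Core (proj₁ C)

lemma5 : (n : ℕ) → 1 ≤ n → (G : Graph n) → IsSimple G →
    ¬ Induced K13 G → ¬ Induced K3 G → ¬ Induced P3 G →
    ((v : Fin n) → ∃[ c ] Σ (Fin (csize c) → Fin n) λ f →
        Injective _≡_ _≡_ f × (∀ a b → G (f a) (f b) ≡ cgraph c a b)
        × (∀ u → (Reach G v u ⇔ (∃[ a ] f a ≡ u))))
    × edges G ≤ h n ∸ 1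
    × ((edges G ≡ h n ∸ 1) ⇔ (∃[ J ] Iso G (jgraph J ⊕ copies (n / 4) C4)))
lemma5 n 1≤n G s no-K13 no-K3 no-P3 =
  component-structure G s F , edge-bound , mk⇔ (extremal-structure 1≤n) (shape-extremal G s)
  where
  F : Forbidden G
  F = no-K13 , no-K3 , no-P3
  open Extremal G s F
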